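{- Let $n,r$ be nonnegative integers with $2\leq r\leq\lceil n/2\rceil$. Then there is a stable configuration $K^*$, reachable from the pulse $K(n,r)$ by a finite sequence of firing moves, such that $K^*\neq \mathrm{Az}(n)$.
   Context: The grid complex is the tiling of the plane by unit squares ("faces"); two faces are adjacent if they share an edge, and $\mathrm{dist}(f,g)$ is the Manhattan distance between faces. A configuration $K$ assigns an integer weight $K_f$ to each face $f$, with finitely many nonzero weights; there is a marked face $f_0$ with $K_{f_0}=n$. Firing moves: (i) if $f,g$ are adjacent faces, both different from $f_0$, with $K_f\geq K_g+2$, one may fire $f$ towards $g$, decreasing $K_f$ by $1$ and increasing $K_g$ by $1$; (ii) if $g$ is adjacent to $f_0$ and $K_g<n$, one may fire from $f_0$ to $g$, increasing $K_g$ by $1$; (iii) if $g$ is adjacent to $f_0$ and $K_g>n$, one may fire from $g$ to $f_0$, decreasing $K_g$ by $1$; the weight of $f_0$ never changes. A configuration is stable if no firing move is possible. The pulse $K(n,r)$ has $K(n,r)_f=n$ if $\mathrm{dist}(f_0,f)\leq r$ and $0$ otherwise. The Aztec diamond $\mathrm{Az}(n)$ has $\mathrm{Az}(n)_{f_0}=n$ and $\mathrm{Az}(n)_f=\max\{n-\mathrm{dist}(f_0,f)+1,0\}$ for $f\neq f_0$. -}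

module Defs where

open import Data.Nat as ℕ using (ℕ; _∸_; _≤?_)
open import Data.Integer as ℤ using (ℤ; +_; ∣_∣)
open import Data.Product using (_×_; _,_)
open import Data.Product.Properties using (≡-dec)
open import Relation.Binary.PropositionalEquality using (_≡_; _≢_)
open import Relation.Nullary using (¬_; yes; no)
open import Relation.Binary.Construct.Closure.ReflexiveTransitive using (Star)

-- Faces of the grid complex, indexed by ℤ × ℤ; the marked face f₀ is the origin.
Face : Set
Face = ℤ × ℤ

f₀ : Face
f₀ = (+ 0 , + 0)

_≟F_ : (f g : Face) → Relation.Nullary.Dec (f ≡ g)
_≟F_ = ≡-dec ℤ._≟_ ℤ._≟_

dist : Face → Face → ℕ
dist (a , b) (c , d) = ∣ a ℤ.- c ∣ ℕ.+ ∣ b ℤ.- d ∣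

Adjacent : Face → Face → Set
Adjacent f g = dist f g ≡ 1

Config : Set
Config = Face → ℤ

fireTo : Face → Face → Config → Config
fireTo f g K h with h ≟F f
... | yes _ = K h ℤ.- + 1
... | no _ with h ≟F g
...   | yes _ = K h ℤ.+ + 1
...   | no _  = K h

incr : Face → Config → Config
incr g K h with h ≟F g
... | yes _ = K h ℤ.+ + 1
... | no _  = K h

decr : Face → Config → Config
decr g K h with h ≟F g
... | yes _ = K h ℤ.- + 1
... | no _  = K h

-- One firing move (the marked face f₀ carries weight n)
data Step (n : ℕ) (K : Config) : Config → Set where
  fire   : (f g : Face) → Adjacent f g → f ≢ f₀ → g ≢ f₀ →
           K g ℤ.+ + 2 ℤ.≤ K f → Step n K (fireTo f g K)
  fromF₀ : (g : Face) → Adjacent g f₀ → K g ℤ.< + n → Step n K (incr g K)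
  toF₀   : (g : Face) → Adjacent g f₀ → + n ℤ.< K g → Step n K (decr g K)

Reachable : ℕ → Config → Config → Set
Reachable n = Star (Step n)

Stable : ℕ → Config → Set
Stable n K = ∀ K′ → ¬ Step n K K′

pulse : ℕ → ℕ → Config
pulse n r f with dist f₀ f ≤? r
... | yes _ = + n
... | no _  = + 0

Az : ℕ → Config
Az n f with f ≟F f₀
... | yes _ = + n
... | no _  = + (ℕ.suc n ∸ dist f₀ f)

-- Every move strictly decreases the energy Σ (K f − n)², summed over a box around f₀, as long
-- as the weights stay nonnegative and below the cone K f + dist f₀ f ≤ n + r, which every move
-- preserves; hence relaxing (always making some move until none is left) terminates.
-- First relax while never firing the face (1,1), so that it keeps weight ≥ n. In the result,
-- weights drop by at most 1 along each edge not leaving (1,1), so the row y = 1 carries weight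
-- ≥ n − j at (j,1); firing along that row pushes the surplus at (1,1) out to (n,1), at distance
-- n + 1 from f₀. A positive weight stays positive under every move, so relaxing once more gives a
-- stable configuration that is positive at (n,1), where Az(n) vanishes.
module Submission where

open import Defs
open import Data.Nat using (ℕ; _≤_; ⌈_/2⌉)
open import Data.Product using (Σ; _×_)
open import Relation.Binary.PropositionalEquality using (_≡_)
open import Relation.Nullary using (¬_)

open import Data.Empty using (⊥-elim)
open import Data.Fin as Fin using (Fin; toℕ)
import Data.Fin.Properties as Fin
open import Data.Integer as ℤ using (ℤ; +_; -[1+_]; ∣_∣; +≤+)
import Data.Integer.Properties as ℤ
open import Data.Integer.Tactic.RingSolver using (solve-∀)
open import Data.Nat as ℕ using (zero; suc; z≤n; s≤s)
import Data.Nat.Induction as ℕ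
import Data.Nat.Properties as ℕ
open import Data.Product as Product using (_,_; ∃; proj₁; proj₂; uncurry)
open import Data.Sum using (_⊎_; inj₁; inj₂)
open import Data.Vec.Functional using (Vector; removeAt)
open import Function using (_∘_)
open import Induction.WellFounded using (Acc; acc)
open import Relation.Binary.Construct.Closure.ReflexiveTransitive using (ε; _◅_; _◅◅_)
open import Relation.Binary.PropositionalEquality
  using (_≢_; refl; sym; trans; cong; cong₂; subst; module ≡-Reasoning)
open import Relation.Nullary using (yes; no; Dec; ¬?; _×-dec_)
open import Relation.Nullary.Decidable using (decidable-stable)
open import Relation.Unary using (Decidable; ∅)
open import Relation.Unary.Properties using (∅?)

open import Algebra.Properties.CommutativeMonoid.Sum ℤ.+-0-commutativeMonoid
  using (sum; sum-remove; sum-cong-≗)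
open import Algebra.Properties.CommutativeSemigroup ℕ.+-commutativeSemigroup
  using () renaming (interchange to +-interchange)

-- Used for all linear arithmetic below: the ring solver proves the equation, and the slack k is
-- a sum of visibly nonnegative terms.
≤-by-difference : ∀ {i j} k → j ℤ.- i ≡ k → + 0 ℤ.≤ k → i ℤ.≤ j
≤-by-difference k eq 0≤k = ℤ.0≤i-j⇒j≤i (subst (+ 0 ℤ.≤_) (sym eq) 0≤k)

i-1≤i : ∀ i → i ℤ.- + 1 ℤ.≤ i
i-1≤i i = ℤ.i≤j⇒i-k≤j (+ 1) ℤ.≤-refl

0≤i⇒0≤i+1 : ∀ {i} → + 0 ℤ.≤ i → + 0 ℤ.≤ i ℤ.+ + 1
0≤i⇒0≤i+1 {i} 0≤i = ℤ.≤-trans 0≤i (ℤ.i≤i+j i (+ 1))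

+m<i⇒1≤i : ∀ {m i} → + m ℤ.< i → + 1 ℤ.≤ i
+m<i⇒1≤i {m} m<i = ℤ.i<j⇒suc[i]≤j (ℤ.≤-<-trans (+≤+ z≤n) m<i)

+m<i⇒+m≤i-1 : ∀ {m i} → + m ℤ.< i → + m ℤ.≤ i ℤ.- + 1
+m<i⇒+m≤i-1 {m} {i} m<i =
  ≤-by-difference (i ℤ.- ℤ.suc (+ m)) (eq i (+ m)) (ℤ.i≤j⇒0≤j-i (ℤ.i<j⇒suc[i]≤j m<i))
  where
  eq : ∀ i m → (i ℤ.- + 1) ℤ.- m ≡ i ℤ.- (+ 1 ℤ.+ m)
  eq = solve-∀

¬[j+2≤i]⇒i-1≤j : ∀ i j → ¬ (j ℤ.+ + 2 ℤ.≤ i) → i ℤ.- + 1 ℤ.≤ j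
¬[j+2≤i]⇒i-1≤j i j ≰ =
  ≤-by-difference ((j ℤ.+ + 2) ℤ.- ℤ.suc i) (eq i j) (ℤ.i≤j⇒0≤j-i (ℤ.i<j⇒suc[i]≤j (ℤ.≰⇒> ≰)))
  where
  eq : ∀ i j → j ℤ.- (i ℤ.- + 1) ≡ (j ℤ.+ + 2) ℤ.- (+ 1 ℤ.+ i)
  eq = solve-∀

i+k≤m⇒i-1+k≤m : ∀ i {k m} → i ℤ.+ k ℤ.≤ m → (i ℤ.- + 1) ℤ.+ k ℤ.≤ m
i+k≤m⇒i-1+k≤m i {k} {m} i+k≤m =
  ≤-by-difference ((m ℤ.- (i ℤ.+ k)) ℤ.+ + 1) (eq i k m) (ℤ.+-mono-≤ (ℤ.i≤j⇒0≤j-i i+k≤m) (+≤+ z≤n))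
  where
  eq : ∀ i k m → m ℤ.- ((i ℤ.- + 1) ℤ.+ k) ≡ (m ℤ.- (i ℤ.+ k)) ℤ.+ + 1
  eq = solve-∀

fire-leaves-source-positive : ∀ {a b} → + 0 ℤ.≤ b → b ℤ.+ + 2 ℤ.≤ a → + 1 ℤ.≤ a ℤ.- + 1
fire-leaves-source-positive {a} {b} 0≤b b+2≤a =
  ≤-by-difference ((a ℤ.- (b ℤ.+ + 2)) ℤ.+ b) (eq a b) (ℤ.+-mono-≤ (ℤ.i≤j⇒0≤j-i b+2≤a) 0≤b)
  where
  eq : ∀ a b → (a ℤ.- + 1) ℤ.- + 1 ≡ (a ℤ.- (b ℤ.+ + 2)) ℤ.+ b
  eq = solve-∀

fire-source-positive : ∀ {a b} → + 0 ℤ.≤ b → b ℤ.+ + 2 ℤ.≤ a → + 1 ℤ.≤ a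
fire-source-positive {a} 0≤b b+2≤a = ℤ.≤-trans (fire-leaves-source-positive 0≤b b+2≤a) (i-1≤i a)

fire-target-cone : ∀ a b {da db m} → b ℤ.+ + 2 ℤ.≤ a → a ℤ.+ da ℤ.≤ m → db ℤ.≤ da ℤ.+ + 1 →
                   (b ℤ.+ + 1) ℤ.+ db ℤ.≤ m
fire-target-cone a b {da} {db} {m} b+2≤a a+da≤m db≤da+1 =
  ≤-by-difference ((a ℤ.- (b ℤ.+ + 2)) ℤ.+ ((m ℤ.- (a ℤ.+ da)) ℤ.+ ((da ℤ.+ + 1) ℤ.- db)))
    (eq a b da db m)
    (ℤ.+-mono-≤ (ℤ.i≤j⇒0≤j-i b+2≤a) (ℤ.+-mono-≤ (ℤ.i≤j⇒0≤j-i a+da≤m) (ℤ.i≤j⇒0≤j-i db≤da+1)))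
  where
  eq : ∀ a b da db m → m ℤ.- ((b ℤ.+ + 1) ℤ.+ db)
                       ≡ (a ℤ.- (b ℤ.+ + 2)) ℤ.+ ((m ℤ.- (a ℤ.+ da)) ℤ.+ ((da ℤ.+ + 1) ℤ.- db))
  eq = solve-∀

sum-nonneg : ∀ {m} (u : Vector ℤ m) → (∀ i → + 0 ℤ.≤ u i) → + 0 ℤ.≤ sum u
sum-nonneg {zero}  u _   = ℤ.≤-refl
sum-nonneg {suc m} u 0≤u = ℤ.+-mono-≤ (0≤u Fin.zero) (sum-nonneg (u ∘ Fin.suc) (0≤u ∘ Fin.suc))

sum-update : ∀ {m} (u v : Vector ℤ m) i → (∀ j → j ≢ i → u j ≡ v j) →
             sum u ℤ.+ v i ≡ sum v ℤ.+ u i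
sum-update {suc m} u v i agree = begin
  sum u ℤ.+ v i                          ≡⟨ cong (ℤ._+ v i) (sum-remove {i = i} u) ⟩
  (u i ℤ.+ sum (removeAt u i)) ℤ.+ v i   ≡⟨ cong (λ s → (u i ℤ.+ s) ℤ.+ v i) removed-agree ⟩
  (u i ℤ.+ sum (removeAt v i)) ℤ.+ v i   ≡⟨ exchange (u i) (sum (removeAt v i)) (v i) ⟩
  (v i ℤ.+ sum (removeAt v i)) ℤ.+ u i   ≡⟨ cong (ℤ._+ u i) (sum-remove {i = i} v) ⟨
  sum v ℤ.+ u i                          ∎
  where
  open ≡-Reasoning
  removed-agree : sum (removeAt u i) ≡ sum (removeAt v i)
  removed-agree = sum-cong-≗ (λ j → agree (Fin.punchIn i j) (Fin.punchInᵢ≢i i j))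
  exchange : ∀ x s y → (x ℤ.+ s) ℤ.+ y ≡ (y ℤ.+ s) ℤ.+ x
  exchange = solve-∀

dist₀ : Face → ℕ
dist₀ = dist f₀

dist-sym : ∀ f g → dist f g ≡ dist g f
dist-sym (a , b) (c , d) = cong₂ ℕ._+_ (ℤ.∣i-j∣≡∣j-i∣ a c) (ℤ.∣i-j∣≡∣j-i∣ b d)

dist-triangle : ∀ f g h → dist f h ℕ.≤ dist f g ℕ.+ dist g h
dist-triangle (a , b) (c , d) (e , h) = ℕ.≤-trans
  (ℕ.+-mono-≤ (∣-∣-triangle a c e) (∣-∣-triangle b d h))
  (ℕ.≤-reflexive (+-interchange (∣ a ℤ.- c ∣) (∣ c ℤ.- e ∣) (∣ b ℤ.- d ∣) (∣ d ℤ.- h ∣)))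
  where
  ∣-∣-triangle : ∀ x y z → ∣ x ℤ.- z ∣ ℕ.≤ ∣ x ℤ.- y ∣ ℕ.+ ∣ y ℤ.- z ∣
  ∣-∣-triangle x y z = subst (λ w → ∣ w ∣ ℕ.≤ ∣ x ℤ.- y ∣ ℕ.+ ∣ y ℤ.- z ∣)
    (ℤ.+-minus-telescope x y z) (ℤ.∣i+j∣≤∣i∣+∣j∣ (x ℤ.- y) (y ℤ.- z))

dist₀-coords : ∀ a b → dist₀ (a , b) ≡ ∣ a ∣ ℕ.+ ∣ b ∣
dist₀-coords a b = cong₂ ℕ._+_ (∣0-i∣≡∣i∣ a) (∣0-i∣≡∣i∣ b)
  where
  ∣0-i∣≡∣i∣ : ∀ i → ∣ + 0 ℤ.- i ∣ ≡ ∣ i ∣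
  ∣0-i∣≡∣i∣ i = trans (cong ∣_∣ (ℤ.+-identityˡ (ℤ.- i))) (ℤ.∣-i∣≡∣i∣ i)

dist₀-adjacent : ∀ f g → Adjacent f g → dist₀ g ℕ.≤ dist₀ f ℕ.+ 1
dist₀-adjacent f g adj = subst (λ k → dist₀ g ℕ.≤ dist₀ f ℕ.+ k) adj (dist-triangle f₀ f g)

dist₀-adjacent-f₀ : ∀ g → Adjacent g f₀ → dist₀ g ≡ 1
dist₀-adjacent-f₀ g adj = trans (dist-sym f₀ g) adj

adjacent⇒≢ : ∀ f g → Adjacent f g → f ≢ g
adjacent⇒≢ (a , b) _ adj refl = ℕ.0≢1+n (trans (sym dist-self) adj)
  where
  dist-self : dist (a , b) (a , b) ≡ 0
  dist-self = cong₂ (λ x y → ∣ x ∣ ℕ.+ ∣ y ∣) (ℤ.+-inverseʳ a) (ℤ.+-inverseʳ b)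

adjacent-right : ∀ k b → Adjacent (+ k , b) (+ suc k , b)
adjacent-right k b = cong₂ ℕ._+_ ∣k-[1+k]∣≡1 (cong ∣_∣ (ℤ.+-inverseʳ b))
  where
  open ≡-Reasoning
  ∣k-[1+k]∣≡1 : ∣ + k ℤ.- + suc k ∣ ≡ 1
  ∣k-[1+k]∣≡1 = begin
    ∣ k ℤ.⊖ suc k ∣             ≡⟨ cong ∣_∣ (ℤ.⊖-≤ (ℕ.n≤1+n k)) ⟩
    ∣ ℤ.- + (suc k ℕ.∸ k) ∣     ≡⟨ ℤ.∣-i∣≡∣i∣ (+ (suc k ℕ.∸ k)) ⟩
    suc k ℕ.∸ k                 ≡⟨ ℕ.m+n∸n≡m 1 k ⟩
    1                           ∎

adjacent-up : ∀ a → Adjacent (a , + 0) (a , + 1)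
adjacent-up a = cong (ℕ._+ 1) (cong ∣_∣ (ℤ.+-inverseʳ a))

Az-outside : ∀ n f → n ℕ.< dist₀ f → Az n f ≡ + 0
Az-outside n f n<d with f ≟F f₀
... | yes refl = ⊥-elim (ℕ.n≮0 n<d)
... | no _     = cong +_ (ℕ.m≤n⇒m∸n≡0 n<d)

fireTo-elim : ∀ (P : Face → ℤ → Set) f g K →
              P f (K f ℤ.- + 1) → P g (K g ℤ.+ + 1) → (∀ x → x ≢ f → x ≢ g → P x (K x)) →
              ∀ x → P x (fireTo f g K x)
fireTo-elim P f g K Pf Pg Pother x with x ≟F f
... | yes refl = Pf
... | no x≢f with x ≟F g
...   | yes refl = Pg
...   | no x≢g   = Pother x x≢f x≢g

incr-elim : ∀ (P : Face → ℤ → Set) g K →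
            P g (K g ℤ.+ + 1) → (∀ x → x ≢ g → P x (K x)) → ∀ x → P x (incr g K x)
incr-elim P g K Pg Pother x with x ≟F g
... | yes refl = Pg
... | no x≢g   = Pother x x≢g

decr-elim : ∀ (P : Face → ℤ → Set) g K →
            P g (K g ℤ.- + 1) → (∀ x → x ≢ g → P x (K x)) → ∀ x → P x (decr g K x)
decr-elim P g K Pg Pother x with x ≟F g
... | yes refl = Pg
... | no x≢g   = Pother x x≢g

incr-self : ∀ g K → incr g K g ≡ K g ℤ.+ + 1
incr-self g K = incr-elim (λ x v → x ≡ g → v ≡ K g ℤ.+ + 1) g K
  (λ _ → refl) (λ _ x≢g x≡g → ⊥-elim (x≢g x≡g)) g refl

incr-other : ∀ g K x → x ≢ g → incr g K x ≡ K x
incr-other g K = incr-elim (λ x v → x ≢ g → v ≡ K x) g K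
  (λ g≢g → ⊥-elim (g≢g refl)) (λ _ _ _ → refl)

decr-self : ∀ g K → decr g K g ≡ K g ℤ.- + 1
decr-self g K = decr-elim (λ x v → x ≡ g → v ≡ K g ℤ.- + 1) g K
  (λ _ → refl) (λ _ x≢g x≡g → ⊥-elim (x≢g x≡g)) g refl

decr-other : ∀ g K x → x ≢ g → decr g K x ≡ K x
decr-other g K = decr-elim (λ x v → x ≢ g → v ≡ K x) g K
  (λ g≢g → ⊥-elim (g≢g refl)) (λ _ _ _ → refl)

fireTo≗incr∘decr : ∀ f g K → g ≢ f → ∀ x → fireTo f g K x ≡ incr g (decr f K) x
fireTo≗incr∘decr f g K g≢f = fireTo-elim (λ x v → v ≡ incr g (decr f K) x) f g K
  (sym (trans (incr-other g (decr f K) f (g≢f ∘ sym)) (decr-self f K)))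
  (sym (trans (incr-self g (decr f K)) (cong (ℤ._+ + 1) (decr-other f K g g≢f))))
  (λ x x≢f x≢g → sym (trans (incr-other g (decr f K) x x≢g) (decr-other f K x x≢f)))

fireTo-target : ∀ f g K → g ≢ f → fireTo f g K g ≡ K g ℤ.+ + 1
fireTo-target f g K g≢f = trans (fireTo≗incr∘decr f g K g≢f g)
  (trans (incr-self g (decr f K)) (cong (ℤ._+ + 1) (decr-other f K g g≢f)))

source : ∀ {n K K′} → Step n K K′ → Face
source (fire f _ _ _ _ _) = f
source (fromF₀ _ _ _)     = f₀
source (toF₀ g _ _)       = g

step-monotone-off-source : ∀ {n K K′} (s : Step n K K′) x → x ≢ source s → K x ℤ.≤ K′ x
step-monotone-off-source {K = K} (fire f g _ _ _ _) = fireTo-elim (λ x v → x ≢ f → K x ℤ.≤ v) f g K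
  (λ f≢f → ⊥-elim (f≢f refl)) (λ _ → ℤ.i≤i+j (K g) (+ 1)) (λ _ _ _ _ → ℤ.≤-refl)
step-monotone-off-source {K = K} (fromF₀ g _ _) x _ = incr-elim (λ x v → K x ℤ.≤ v) g K
  (ℤ.i≤i+j (K g) (+ 1)) (λ _ _ → ℤ.≤-refl) x
step-monotone-off-source {K = K} (toF₀ g _ _) = decr-elim (λ x v → x ≢ g → K x ℤ.≤ v) g K
  (λ g≢g → ⊥-elim (g≢g refl)) (λ _ _ _ → ℤ.≤-refl)

step-preserves-positive : ∀ {n K K′} → 1 ℕ.≤ n → (∀ x → + 0 ℤ.≤ K x) → Step n K K′ →
                          ∀ x → + 1 ℤ.≤ K x → + 1 ℤ.≤ K′ x
step-preserves-positive {K = K} _ nonneg (fire f g _ _ _ b+2≤a) =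
  fireTo-elim (λ x v → + 1 ℤ.≤ K x → + 1 ℤ.≤ v) f g K
    (λ _ → fire-leaves-source-positive (nonneg g) b+2≤a)
    (λ 1≤Kg → ℤ.≤-trans 1≤Kg (ℤ.i≤i+j (K g) (+ 1))) (λ _ _ _ 1≤Kx → 1≤Kx)
step-preserves-positive {K = K} _ _ (fromF₀ g _ _) =
  incr-elim (λ x v → + 1 ℤ.≤ K x → + 1 ℤ.≤ v) g K
    (λ 1≤Kg → ℤ.≤-trans 1≤Kg (ℤ.i≤i+j (K g) (+ 1))) (λ _ _ 1≤Kx → 1≤Kx)
step-preserves-positive {K = K} 1≤n _ (toF₀ g _ n<Kg) =
  decr-elim (λ x v → + 1 ℤ.≤ K x → + 1 ℤ.≤ v) g K
    (λ _ → ℤ.≤-trans (+≤+ 1≤n) (+m<i⇒+m≤i-1 n<Kg)) (λ _ _ 1≤Kx → 1≤Kx)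

module Box (M : ℕ) where

  W : ℕ
  W = suc (M ℕ.+ M)

  coord : Fin W → ℤ
  coord i = + toℕ i ℤ.- + M

  coord-injective : ∀ {i j} → coord i ≡ coord j → i ≡ j
  coord-injective {i} {j} eq = Fin.toℕ-injective (ℤ.+-injective (begin
    + toℕ i           ≡⟨ x≡[x-y]+y (+ toℕ i) (+ M) ⟩
    coord i ℤ.+ + M   ≡⟨ cong (ℤ._+ + M) eq ⟩
    coord j ℤ.+ + M   ≡⟨ x≡[x-y]+y (+ toℕ j) (+ M) ⟨
    + toℕ j           ∎))
    where
    open ≡-Reasoning
    x≡[x-y]+y : ∀ x y → x ≡ (x ℤ.- y) ℤ.+ y
    x≡[x-y]+y = solve-∀

  coord-surjective : ∀ a → ∣ a ∣ ℕ.≤ M → ∃ λ i → coord i ≡ a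
  coord-surjective (+ m) m≤M = Fin.fromℕ< M+m<W , (begin
    + toℕ (Fin.fromℕ< M+m<W) ℤ.- + M   ≡⟨ cong (λ k → + k ℤ.- + M) (Fin.toℕ-fromℕ< M+m<W) ⟩
    + (M ℕ.+ m) ℤ.- + M                 ≡⟨ ℤ.m-n≡m⊖n (M ℕ.+ m) M ⟩
    (M ℕ.+ m) ℤ.⊖ M                     ≡⟨ ℤ.⊖-≥ (ℕ.m≤m+n M m) ⟩
    + (M ℕ.+ m ℕ.∸ M)                   ≡⟨ cong +_ (ℕ.m+n∸m≡n M m) ⟩
    + m                                 ∎)
    where
    open ≡-Reasoning
    M+m<W : M ℕ.+ m ℕ.< W
    M+m<W = s≤s (ℕ.+-monoʳ-≤ M m≤M)
  coord-surjective -[1+ m ] m<M = Fin.fromℕ< M-m<W , (begin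
    + toℕ (Fin.fromℕ< M-m<W) ℤ.- + M   ≡⟨ cong (λ k → + k ℤ.- + M) (Fin.toℕ-fromℕ< M-m<W) ⟩
    + (M ℕ.∸ suc m) ℤ.- + M             ≡⟨ ℤ.m-n≡m⊖n (M ℕ.∸ suc m) M ⟩
    (M ℕ.∸ suc m) ℤ.⊖ M                 ≡⟨ ℤ.⊖-≤ (ℕ.m∸n≤m M (suc m)) ⟩
    ℤ.- + (M ℕ.∸ (M ℕ.∸ suc m))         ≡⟨ cong (λ k → ℤ.- + k) (ℕ.m∸[m∸n]≡n m<M) ⟩
    -[1+ m ]                            ∎)
    where
    open ≡-Reasoning
    M-m<W : M ℕ.∸ suc m ℕ.< W
    M-m<W = s≤s (ℕ.≤-trans (ℕ.m∸n≤m M (suc m)) (ℕ.m≤m+n M M))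

  boxFace : Fin (W ℕ.* W) → Face
  boxFace k = Product.map coord coord (Fin.remQuot {W} W k)

  boxFace-injective : ∀ {k l} → boxFace k ≡ boxFace l → k ≡ l
  boxFace-injective {k} {l} eq = begin
    k                                         ≡⟨ Fin.combine-remQuot {W} W k ⟨
    uncurry Fin.combine (Fin.remQuot {W} W k) ≡⟨ cong (uncurry Fin.combine) same-coords ⟩
    uncurry Fin.combine (Fin.remQuot {W} W l) ≡⟨ Fin.combine-remQuot {W} W l ⟩
    l                                         ∎
    where
    open ≡-Reasoning
    same-coords : Fin.remQuot {W} W k ≡ Fin.remQuot {W} W l
    same-coords = cong₂ _,_ (coord-injective (cong proj₁ eq)) (coord-injective (cong proj₂ eq))

  boxFace-surjective : ∀ f → dist₀ f ℕ.≤ M → ∃ λ k → boxFace k ≡ f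
  boxFace-surjective (a , b) d≤M with coord-surjective a ∣a∣≤M | coord-surjective b ∣b∣≤M
    where
    ∣a∣+∣b∣≤M : ∣ a ∣ ℕ.+ ∣ b ∣ ℕ.≤ M
    ∣a∣+∣b∣≤M = subst (ℕ._≤ M) (dist₀-coords a b) d≤M
    ∣a∣≤M = ℕ.m+n≤o⇒m≤o (∣ a ∣) ∣a∣+∣b∣≤M
    ∣b∣≤M = ℕ.m+n≤o⇒n≤o (∣ a ∣) ∣a∣+∣b∣≤M
  ... | i , refl | j , refl = Fin.combine i j , cong (Product.map coord coord) (Fin.remQuot-combine i j)

  in-box : ∀ {P : Face → Set} f → dist₀ f ℕ.≤ M → P f → ∃ λ k → P (boxFace k)
  in-box f d≤M Pf with boxFace-surjective f d≤M
  ... | k , refl = k , Pf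

module Cone (n M : ℕ) (n<M : n ℕ.< M) where

  record Bounded (K : Config) : Set where
    field
      nonneg : ∀ x → + 0 ℤ.≤ K x
      cone   : ∀ x → + 1 ℤ.≤ K x → K x ℤ.+ + dist₀ x ℤ.≤ + M

  open Bounded public

  private
    feed-cone : ∀ b → b ℤ.< + n → (b ℤ.+ + 1) ℤ.+ + 1 ℤ.≤ + M
    feed-cone b b<n = ≤-by-difference ((+ n ℤ.- ℤ.suc b) ℤ.+ (+ M ℤ.- + suc n)) (eq b (+ n) (+ M))
      (ℤ.+-mono-≤ (ℤ.i≤j⇒0≤j-i (ℤ.i<j⇒suc[i]≤j b<n)) (ℤ.i≤j⇒0≤j-i (+≤+ n<M)))
      where
      eq : ∀ b n M → M ℤ.- ((b ℤ.+ + 1) ℤ.+ + 1) ≡ (n ℤ.- (+ 1 ℤ.+ b)) ℤ.+ (M ℤ.- (+ 1 ℤ.+ n))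
      eq = solve-∀

  bounded-step : ∀ {K K′} → Bounded K → Step n K K′ → Bounded K′
  bounded-step {K} β (fire f g adj _ _ b+2≤a) = record
    { nonneg = fireTo-elim (λ _ v → + 0 ℤ.≤ v) f g K
                 (ℤ.≤-trans (+≤+ z≤n) (fire-leaves-source-positive (nonneg β g) b+2≤a))
                 (0≤i⇒0≤i+1 (nonneg β g)) (λ x _ _ → nonneg β x)
    ; cone   = fireTo-elim (λ x v → + 1 ℤ.≤ v → v ℤ.+ + dist₀ x ℤ.≤ + M) f g K
                 (λ _ → i+k≤m⇒i-1+k≤m (K f) f-cone)
                 (λ _ → fire-target-cone (K f) (K g) b+2≤a f-cone (+≤+ (dist₀-adjacent f g adj)))
                 (λ x _ _ → cone β x)
    }
    where
    f-cone : K f ℤ.+ + dist₀ f ℤ.≤ + M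
    f-cone = cone β f (fire-source-positive (nonneg β g) b+2≤a)
  bounded-step {K} β (fromF₀ g adj b<n) = record
    { nonneg = incr-elim (λ _ v → + 0 ℤ.≤ v) g K (0≤i⇒0≤i+1 (nonneg β g)) (λ x _ → nonneg β x)
    ; cone   = incr-elim (λ x v → + 1 ℤ.≤ v → v ℤ.+ + dist₀ x ℤ.≤ + M) g K
                 (λ _ → subst (λ d → (K g ℤ.+ + 1) ℤ.+ + d ℤ.≤ + M) (sym (dist₀-adjacent-f₀ g adj))
                              (feed-cone (K g) b<n))
                 (λ x _ → cone β x)
    }
  bounded-step {K} β (toF₀ g adj n<b) = record
    { nonneg = decr-elim (λ _ v → + 0 ℤ.≤ v) g K (ℤ.i≤j⇒0≤j-i (+m<i⇒1≤i n<b)) (λ x _ → nonneg β x)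
    ; cone   = decr-elim (λ x v → + 1 ℤ.≤ v → v ℤ.+ + dist₀ x ℤ.≤ + M) g K
                 (λ _ → i+k≤m⇒i-1+k≤m (K g) (cone β g (+m<i⇒1≤i n<b)))
                 (λ x _ → cone β x)
    }

  bounded-reachable : ∀ {K K′} → Bounded K → Reachable n K K′ → Bounded K′
  bounded-reachable β ε        = β
  bounded-reachable β (s ◅ ss) = bounded-reachable (bounded-step β s) ss

  positive⇒dist₀<M : ∀ {K} → Bounded K → ∀ x → + 1 ℤ.≤ K x → dist₀ x ℕ.< M
  positive⇒dist₀<M β x 1≤Kx = ℤ.drop‿+≤+ (ℤ.≤-trans (ℤ.+-monoˡ-≤ (+ dist₀ x) 1≤Kx) (cone β x 1≤Kx))

  fire-source-in-box : ∀ {K f g} → Bounded K → K g ℤ.+ + 2 ℤ.≤ K f → dist₀ f ℕ.< M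
  fire-source-in-box {f = f} {g} β b+2≤a = positive⇒dist₀<M β f (fire-source-positive (nonneg β g) b+2≤a)

  fire-target-in-box : ∀ {K} f g → Bounded K → Adjacent f g → K g ℤ.+ + 2 ℤ.≤ K f → dist₀ g ℕ.≤ M
  fire-target-in-box f g β adj b+2≤a = ℕ.≤-trans (dist₀-adjacent f g adj)
    (subst (ℕ._≤ M) (ℕ.+-comm 1 (dist₀ f)) (fire-source-in-box β b+2≤a))

  adjacent-f₀-in-box : ∀ g → Adjacent g f₀ → dist₀ g ℕ.≤ M
  adjacent-f₀-in-box g adj = subst (ℕ._≤ M) (sym (dist₀-adjacent-f₀ g adj)) (ℕ.≤-trans (s≤s z≤n) n<M)

  open Box M

  deviation : ℤ → ℤ
  deviation v = (v ℤ.- + n) ℤ.* (v ℤ.- + n)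

  energy : Config → ℤ
  energy K = sum (λ k → deviation (K (boxFace k)))

  energy-nonneg : ∀ K → + 0 ℤ.≤ energy K
  energy-nonneg K = sum-nonneg _ (λ k → 0≤i*i (K (boxFace k) ℤ.- + n))
    where
    0≤i*i : ∀ i → + 0 ℤ.≤ i ℤ.* i
    0≤i*i (+ zero)  = ℤ.≤-refl
    0≤i*i (+ suc m) = +≤+ z≤n
    0≤i*i -[1+ m ]  = +≤+ z≤n

  energy-update : ∀ {K K′} x → dist₀ x ℕ.≤ M → (∀ y → y ≢ x → K′ y ≡ K y) →
                  energy K′ ℤ.+ deviation (K x) ≡ energy K ℤ.+ deviation (K′ x)
  energy-update x d≤M agree with boxFace-surjective x d≤M
  ... | k , refl = sum-update _ _ k (λ j j≢k → cong deviation (agree (boxFace j) (j≢k ∘ boxFace-injective)))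

  energy-incr : ∀ g K → dist₀ g ℕ.≤ M →
                energy (incr g K) ℤ.+ deviation (K g) ≡ energy K ℤ.+ deviation (K g ℤ.+ + 1)
  energy-incr g K d≤M =
    trans (energy-update g d≤M (incr-other g K)) (cong (λ v → energy K ℤ.+ deviation v) (incr-self g K))

  energy-decr : ∀ g K → dist₀ g ℕ.≤ M →
                energy (decr g K) ℤ.+ deviation (K g) ≡ energy K ℤ.+ deviation (K g ℤ.- + 1)
  energy-decr g K d≤M =
    trans (energy-update g d≤M (decr-other g K)) (cong (λ v → energy K ℤ.+ deviation v) (decr-self g K))

  private
    exchange-≤ : ∀ x u y v → x ℤ.+ u ≡ y ℤ.+ v → v ℤ.+ + 1 ℤ.≤ u → x ℤ.+ + 1 ℤ.≤ y
    exchange-≤ x u y v eq v+1≤u = ≤-by-difference (u ℤ.- (v ℤ.+ + 1)) slack (ℤ.i≤j⇒0≤j-i v+1≤u)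
      where
      open ≡-Reasoning
      rearrange : ∀ x u y v → y ℤ.- (x ℤ.+ + 1) ≡ ((y ℤ.+ v) ℤ.- (x ℤ.+ u)) ℤ.+ (u ℤ.- (v ℤ.+ + 1))
      rearrange = solve-∀
      cancel : ∀ w d → (w ℤ.- w) ℤ.+ d ≡ d
      cancel = solve-∀
      slack : y ℤ.- (x ℤ.+ + 1) ≡ u ℤ.- (v ℤ.+ + 1)
      slack = begin
        y ℤ.- (x ℤ.+ + 1)                                  ≡⟨ rearrange x u y v ⟩
        ((y ℤ.+ v) ℤ.- (x ℤ.+ u)) ℤ.+ (u ℤ.- (v ℤ.+ + 1))   ≡⟨ cong (λ w → (w ℤ.- (x ℤ.+ u)) ℤ.+ _) eq ⟨
        ((x ℤ.+ u) ℤ.- (x ℤ.+ u)) ℤ.+ (u ℤ.- (v ℤ.+ + 1))   ≡⟨ cancel (x ℤ.+ u) _ ⟩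
        u ℤ.- (v ℤ.+ + 1)                                  ∎

    chain : ∀ x u y v u′ z v′ → x ℤ.+ u ≡ y ℤ.+ v → y ℤ.+ u′ ≡ z ℤ.+ v′ →
            x ℤ.+ (u′ ℤ.+ u) ≡ z ℤ.+ (v′ ℤ.+ v)
    chain x u y v u′ z v′ eq₁ eq₂ = begin
      x ℤ.+ (u′ ℤ.+ u)   ≡⟨ swap x u′ u ⟩
      (x ℤ.+ u) ℤ.+ u′   ≡⟨ cong (ℤ._+ u′) eq₁ ⟩
      (y ℤ.+ v) ℤ.+ u′   ≡⟨ swap y u′ v ⟨
      y ℤ.+ (u′ ℤ.+ v)   ≡⟨ ℤ.+-assoc y u′ v ⟨
      (y ℤ.+ u′) ℤ.+ v   ≡⟨ cong (ℤ._+ v) eq₂ ⟩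
      (z ℤ.+ v′) ℤ.+ v   ≡⟨ ℤ.+-assoc z v′ v ⟩
      z ℤ.+ (v′ ℤ.+ v)   ∎
      where
      open ≡-Reasoning
      swap : ∀ a b c → a ℤ.+ (b ℤ.+ c) ≡ (a ℤ.+ c) ℤ.+ b
      swap = solve-∀

    deviation-feed : ∀ b → b ℤ.< + n → deviation (b ℤ.+ + 1) ℤ.+ + 1 ℤ.≤ deviation b
    deviation-feed b b<n = ≤-by-difference (d ℤ.+ d) (eq b (+ n)) (ℤ.+-mono-≤ 0≤d 0≤d)
      where
      d = + n ℤ.- ℤ.suc b
      0≤d = ℤ.i≤j⇒0≤j-i (ℤ.i<j⇒suc[i]≤j b<n)
      eq : ∀ b n → (b ℤ.- n) ℤ.* (b ℤ.- n)
                     ℤ.- (((b ℤ.+ + 1) ℤ.- n) ℤ.* ((b ℤ.+ + 1) ℤ.- n) ℤ.+ + 1)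
                   ≡ (n ℤ.- (+ 1 ℤ.+ b)) ℤ.+ (n ℤ.- (+ 1 ℤ.+ b))
      eq = solve-∀

    deviation-drain : ∀ b → + n ℤ.< b → deviation (b ℤ.- + 1) ℤ.+ + 1 ℤ.≤ deviation b
    deviation-drain b n<b = ≤-by-difference (d ℤ.+ d) (eq b (+ n)) (ℤ.+-mono-≤ 0≤d 0≤d)
      where
      d = b ℤ.- ℤ.suc (+ n)
      0≤d = ℤ.i≤j⇒0≤j-i (ℤ.i<j⇒suc[i]≤j n<b)
      eq : ∀ b n → (b ℤ.- n) ℤ.* (b ℤ.- n)
                     ℤ.- (((b ℤ.- + 1) ℤ.- n) ℤ.* ((b ℤ.- + 1) ℤ.- n) ℤ.+ + 1)
                   ≡ (b ℤ.- (+ 1 ℤ.+ n)) ℤ.+ (b ℤ.- (+ 1 ℤ.+ n))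
      eq = solve-∀

    deviation-fire : ∀ a b → b ℤ.+ + 2 ℤ.≤ a →
                     (deviation (a ℤ.- + 1) ℤ.+ deviation (b ℤ.+ + 1)) ℤ.+ + 1
                       ℤ.≤ deviation a ℤ.+ deviation b
    deviation-fire a b b+2≤a =
      ≤-by-difference ((d ℤ.+ d) ℤ.+ + 1) (eq a b (+ n)) (ℤ.+-mono-≤ (ℤ.+-mono-≤ 0≤d 0≤d) (+≤+ z≤n))
      where
      d = a ℤ.- (b ℤ.+ + 2)
      0≤d = ℤ.i≤j⇒0≤j-i b+2≤a
      eq : ∀ a b n → ((a ℤ.- n) ℤ.* (a ℤ.- n) ℤ.+ (b ℤ.- n) ℤ.* (b ℤ.- n))
                     ℤ.- ((((a ℤ.- + 1) ℤ.- n) ℤ.* ((a ℤ.- + 1) ℤ.- n)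
                          ℤ.+ ((b ℤ.+ + 1) ℤ.- n) ℤ.* ((b ℤ.+ + 1) ℤ.- n)) ℤ.+ + 1)
                   ≡ ((a ℤ.- (b ℤ.+ + 2)) ℤ.+ (a ℤ.- (b ℤ.+ + 2))) ℤ.+ + 1
      eq = solve-∀

  energy-step : ∀ {K K′} → Bounded K → Step n K K′ → energy K′ ℤ.+ + 1 ℤ.≤ energy K
  energy-step {K} β (fire f g adj _ _ b+2≤a) =
    subst (λ e → e ℤ.+ + 1 ℤ.≤ energy K)
      (sym (sum-cong-≗ (cong deviation ∘ fireTo≗incr∘decr f g K g≢f ∘ boxFace)))
      (exchange-≤ (energy K″) (deviation (K f) ℤ.+ deviation (K g)) (energy K)
                  (deviation (K f ℤ.- + 1) ℤ.+ deviation (K g ℤ.+ + 1))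
                  (chain (energy K″) (deviation (K g)) (energy K′) (deviation (K g ℤ.+ + 1))
                         (deviation (K f)) (energy K) (deviation (K f ℤ.- + 1)) moved-to-g taken-from-f)
                  (deviation-fire (K f) (K g) b+2≤a))
    where
    K′ K″ : Config
    K′ = decr f K
    K″ = incr g K′
    g≢f : g ≢ f
    g≢f = adjacent⇒≢ f g adj ∘ sym
    taken-from-f : energy K′ ℤ.+ deviation (K f) ≡ energy K ℤ.+ deviation (K f ℤ.- + 1)
    taken-from-f = energy-decr f K (ℕ.<⇒≤ (fire-source-in-box β b+2≤a))
    moved-to-g : energy K″ ℤ.+ deviation (K g) ≡ energy K′ ℤ.+ deviation (K g ℤ.+ + 1)
    moved-to-g = subst (λ v → energy K″ ℤ.+ deviation v ≡ energy K′ ℤ.+ deviation (v ℤ.+ + 1))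
                   (decr-other f K g g≢f) (energy-incr g K′ (fire-target-in-box f g β adj b+2≤a))
  energy-step {K} β (fromF₀ g adj b<n) =
    exchange-≤ (energy (incr g K)) (deviation (K g)) (energy K) (deviation (K g ℤ.+ + 1))
               (energy-incr g K (adjacent-f₀-in-box g adj)) (deviation-feed (K g) b<n)
  energy-step {K} β (toF₀ g adj n<b) =
    exchange-≤ (energy (decr g K)) (deviation (K g)) (energy K) (deviation (K g ℤ.- + 1))
               (energy-decr g K (adjacent-f₀-in-box g adj)) (deviation-drain (K g) n<b)

  ∣energy∣-decreasing : ∀ {K K′} → Bounded K → Step n K K′ → ∣ energy K′ ∣ ℕ.< ∣ energy K ∣
  ∣energy∣-decreasing {K} {K′} β s = ∣∣-mono-< (energy-nonneg K′) (energy-step β s)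
    where
    ∣∣-mono-< : ∀ {i j} → + 0 ℤ.≤ i → i ℤ.+ + 1 ℤ.≤ j → ∣ i ∣ ℕ.< ∣ j ∣
    ∣∣-mono-< {+ a} {+ b} (+≤+ _) (+≤+ a+1≤b) = subst (ℕ._≤ b) (ℕ.+-comm a 1) a+1≤b

module Relaxation (n M : ℕ) (n<M : n ℕ.< M) where

  open Cone n M n<M
  open Box M

  UnfrozenStep : (Face → Set) → Config → Set
  UnfrozenStep F K = Σ Config λ K′ → Σ (Step n K K′) λ s → ¬ F (source s)

  StableOutside : (Face → Set) → Config → Set
  StableOutside F K = ∀ {K′} (s : Step n K K′) → F (source s)

  module _ {F : Face → Set} (F? : Decidable F) where

    private
      CanFire : Config → Face → Face → Set
      CanFire K f g = Adjacent f g × f ≢ f₀ × g ≢ f₀ × ¬ F f × K g ℤ.+ + 2 ℤ.≤ K f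

      CanFeed : Config → Face → Set
      CanFeed K g = Adjacent g f₀ × ¬ F f₀ × K g ℤ.< + n

      CanDrain : Config → Face → Set
      CanDrain K g = Adjacent g f₀ × ¬ F g × + n ℤ.< K g

      canFire? : ∀ K f g → Dec (CanFire K f g)
      canFire? K f g = (dist f g ℕ.≟ 1) ×-dec ¬? (f ≟F f₀) ×-dec ¬? (g ≟F f₀) ×-dec ¬? (F? f)
                       ×-dec (K g ℤ.+ + 2 ℤ.≤? K f)

      canFeed? : ∀ K g → Dec (CanFeed K g)
      canFeed? K g = (dist g f₀ ℕ.≟ 1) ×-dec ¬? (F? f₀) ×-dec (K g ℤ.<? + n)

      canDrain? : ∀ K g → Dec (CanDrain K g)
      canDrain? K g = (dist g f₀ ℕ.≟ 1) ×-dec ¬? (F? g) ×-dec (+ n ℤ.<? K g)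

    unfrozen-step-or-stable : ∀ {K} → Bounded K → UnfrozenStep F K ⊎ StableOutside F K
    unfrozen-step-or-stable {K} β
      with Fin.any? (λ k → Fin.any? (λ l → canFire? K (boxFace k) (boxFace l)))
         | Fin.any? (λ k → canFeed? K (boxFace k)) | Fin.any? (λ k → canDrain? K (boxFace k))
    ... | yes (k , l , adj , f≢f₀ , g≢f₀ , ¬Ff , le) | _ | _ =
      inj₁ (_ , fire (boxFace k) (boxFace l) adj f≢f₀ g≢f₀ le , ¬Ff)
    ... | no _ | yes (k , adj , ¬Ff₀ , lt) | _ = inj₁ (_ , fromF₀ (boxFace k) adj lt , ¬Ff₀)
    ... | no _ | no _ | yes (k , adj , ¬Fg , lt) = inj₁ (_ , toF₀ (boxFace k) adj lt , ¬Fg)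
    ... | no ¬fire | no ¬feed | no ¬drain = inj₂ frozen
      where
      frozen : StableOutside F K
      frozen (fire f g adj f≢f₀ g≢f₀ le) = decidable-stable (F? f) λ ¬Ff → ¬fire
        (in-box f (ℕ.<⇒≤ (fire-source-in-box β le))
          (in-box {CanFire K f} g (fire-target-in-box f g β adj le) (adj , f≢f₀ , g≢f₀ , ¬Ff , le)))
      frozen (fromF₀ g adj lt) = decidable-stable (F? f₀) λ ¬Ff₀ →
        ¬feed (in-box g (adjacent-f₀-in-box g adj) (adj , ¬Ff₀ , lt))
      frozen (toF₀ g adj lt) = decidable-stable (F? g) λ ¬Fg →
        ¬drain (in-box g (adjacent-f₀-in-box g adj) (adj , ¬Fg , lt))

    Relaxed : (Config → Set) → Config → Set
    Relaxed P K = Σ Config λ K* → Reachable n K K* × StableOutside F K* × P K*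

    relax : (P : Config → Set) →
            (∀ {K K′} → Bounded K → P K → (s : Step n K K′) → ¬ F (source s) → P K′) →
            ∀ {K} → Bounded K → P K → Relaxed P K
    relax P preserve = go (ℕ.<-wellFounded _)
      where
      go : ∀ {K} → Acc ℕ._<_ ∣ energy K ∣ → Bounded K → P K → Relaxed P K
      go {K} (acc rs) β p with unfrozen-step-or-stable β
      ... | inj₂ stable = K , ε , stable , p
      ... | inj₁ (K′ , s , ¬Fs)
          with go (rs (∣energy∣-decreasing β s)) (bounded-step β s) (preserve β p s ¬Fs)
      ...   | K* , steps , stable , p* = K* , s ◅ steps , stable , p*

  stable-slope : ∀ {F K} → StableOutside F K → ∀ f g → Adjacent f g → f ≢ f₀ → g ≢ f₀ → ¬ F f →
                 K f ℤ.- + 1 ℤ.≤ K g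
  stable-slope {K = K} stable f g adj f≢f₀ g≢f₀ ¬Ff =
    ¬[j+2≤i]⇒i-1≤j (K f) (K g) (λ le → ¬Ff (stable (fire f g adj f≢f₀ g≢f₀ le)))

  stable-near-f₀ : ∀ {F K} → StableOutside F K → ¬ F f₀ → ∀ g → Adjacent g f₀ → + n ℤ.≤ K g
  stable-near-f₀ stable ¬Ff₀ g adj = ℤ.≮⇒≥ (λ lt → ¬Ff₀ (stable (fromF₀ g adj lt)))

module NonAztecLimit (m r : ℕ) (2≤r : 2 ℕ.≤ r) where

  n M : ℕ
  n = suc m
  M = n ℕ.+ r

  n<M : n ℕ.< M
  n<M = ℕ.m<m+n n (ℕ.≤-trans (s≤s z≤n) 2≤r)

  open Cone n M n<M
  open Relaxation n M n<M

  upper lower : ℕ → Face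
  upper k = (+ k , + 1)
  lower k = (+ k , + 0)

  pulse-bounded : Bounded (pulse n r)
  pulse-bounded = record { nonneg = nonneg′ ; cone = cone′ }
    where
    nonneg′ : ∀ x → + 0 ℤ.≤ pulse n r x
    nonneg′ x with dist f₀ x ℕ.≤? r
    ... | yes _ = +≤+ z≤n
    ... | no _  = ℤ.≤-refl
    cone′ : ∀ x → + 1 ℤ.≤ pulse n r x → pulse n r x ℤ.+ + dist₀ x ℤ.≤ + M
    cone′ x with dist f₀ x ℕ.≤? r
    ... | yes d≤r = λ _ → +≤+ (ℕ.+-monoʳ-≤ n d≤r)
    ... | no _    = λ { (+≤+ ()) }

  pulse-upper-1 : pulse n r (upper 1) ≡ + n
  pulse-upper-1 with dist f₀ (upper 1) ℕ.≤? r
  ... | yes _   = refl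
  ... | no 2≰r = ⊥-elim (2≰r 2≤r)

  -- A surplus of one chip at (k,1) above a ramp of slope −1 along the rest of the row y = 1.
  Ramp : ℕ → Config → Set
  Ramp k K = (+ n ℤ.- + k) ℤ.+ + 1 ℤ.≤ K (upper k) × (∀ j → k ℕ.< j → + n ℤ.- + j ℤ.≤ K (upper j))

  private
    ramp-descent : ∀ c j a b → c ℤ.- + j ℤ.≤ a → a ℤ.- + 1 ℤ.≤ b → c ℤ.- + suc j ℤ.≤ b
    ramp-descent c j a b c-j≤a a-1≤b =
      ≤-by-difference ((b ℤ.- (a ℤ.- + 1)) ℤ.+ (a ℤ.- (c ℤ.- + j))) (eq c (+ j) a b)
        (ℤ.+-mono-≤ (ℤ.i≤j⇒0≤j-i a-1≤b) (ℤ.i≤j⇒0≤j-i c-j≤a))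
      where
      eq : ∀ c j a b → b ℤ.- (c ℤ.- (+ 1 ℤ.+ j)) ≡ (b ℤ.- (a ℤ.- + 1)) ℤ.+ (a ℤ.- (c ℤ.- j))
      eq = solve-∀

  ramp-from-relaxed : ∀ {K} → StableOutside (_≡ upper 1) K → + n ℤ.≤ K (upper 1) → Ramp 1 K
  ramp-from-relaxed {K} stable n≤K =
    subst (ℤ._≤ K (upper 1)) (sym ([x-1]+1≡x (+ n))) n≤K , λ { (suc j) _ → upper-bound j }
    where
    [x-1]+1≡x : ∀ x → (x ℤ.- + 1) ℤ.+ + 1 ≡ x
    [x-1]+1≡x = solve-∀
    slope : ∀ f g → Adjacent f g → f ≢ f₀ → g ≢ f₀ → f ≢ upper 1 → K f ℤ.- + 1 ℤ.≤ K g
    slope = stable-slope {F = _≡ upper 1} stable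
    lower-bound : ∀ j → + n ℤ.- + j ℤ.≤ K (lower (suc j))
    lower-bound zero    = subst (ℤ._≤ K (lower 1)) (sym (ℤ.+-identityʳ (+ n)))
                            (stable-near-f₀ {F = _≡ upper 1} stable (λ ()) (lower 1) refl)
    lower-bound (suc j) = ramp-descent (+ n) j _ _ (lower-bound j)
                            (slope (lower (suc j)) (lower (suc (suc j))) (adjacent-right (suc j) (+ 0))
                                   (λ ()) (λ ()) (λ ()))
    upper-bound : ∀ j → + n ℤ.- + suc j ℤ.≤ K (upper (suc j))
    upper-bound j = ramp-descent (+ n) j _ _ (lower-bound j)
                      (slope (lower (suc j)) (upper (suc j)) (adjacent-up (+ suc j)) (λ ()) (λ ()) (λ ()))

  ramp-step : ∀ k {K} → Ramp k K → Σ Config λ K′ → Reachable n K K′ × Ramp (suc k) K′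
  ramp-step k {K} (peak , slope) with (+ n ℤ.- + suc k) ℤ.+ + 1 ℤ.≤? K (upper (suc k))
  ... | yes raised = K , ε , raised , λ j k+1<j → slope j (ℕ.<-trans (ℕ.n<1+n k) k+1<j)
  ... | no ¬raised = fireTo (upper k) (upper (suc k)) K , step ◅ ε , raised , slope′
    where
    a b : ℤ
    a = K (upper k)
    b = K (upper (suc k))
    b≤n-k-1 : b ℤ.≤ + n ℤ.- + suc k
    b≤n-k-1 = ≤-by-difference (((+ n ℤ.- + suc k) ℤ.+ + 1) ℤ.- ℤ.suc b) (eq₁ (+ n ℤ.- + suc k) b)
                (ℤ.i≤j⇒0≤j-i (ℤ.i<j⇒suc[i]≤j (ℤ.≰⇒> ¬raised)))
      where
      eq₁ : ∀ c x → c ℤ.- x ≡ (c ℤ.+ + 1) ℤ.- (+ 1 ℤ.+ x)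
      eq₁ = solve-∀
    steep : b ℤ.+ + 2 ℤ.≤ a
    steep = ≤-by-difference ((a ℤ.- ((+ n ℤ.- + k) ℤ.+ + 1)) ℤ.+ ((+ n ℤ.- + suc k) ℤ.- b))
              (eq₂ a b (+ n) (+ k))
              (ℤ.+-mono-≤ (ℤ.i≤j⇒0≤j-i peak) (ℤ.i≤j⇒0≤j-i b≤n-k-1))
      where
      eq₂ : ∀ a b n k → a ℤ.- (b ℤ.+ + 2)
                        ≡ (a ℤ.- ((n ℤ.- k) ℤ.+ + 1)) ℤ.+ ((n ℤ.- (+ 1 ℤ.+ k)) ℤ.- b)
      eq₂ = solve-∀
    step : Step n K (fireTo (upper k) (upper (suc k)) K)
    step = fire (upper k) (upper (suc k)) (adjacent-right k (+ 1)) (λ ()) (λ ()) steep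
    raised : (+ n ℤ.- + suc k) ℤ.+ + 1 ℤ.≤ fireTo (upper k) (upper (suc k)) K (upper (suc k))
    raised = subst ((+ n ℤ.- + suc k) ℤ.+ + 1 ℤ.≤_)
               (sym (fireTo-target (upper k) (upper (suc k)) K (adjacent⇒≢ _ _ (adjacent-right k (+ 1)) ∘ sym)))
               (ℤ.+-monoˡ-≤ (+ 1) (slope (suc k) (ℕ.n<1+n k)))
    slope′ : ∀ j → suc k ℕ.< j → + n ℤ.- + j ℤ.≤ fireTo (upper k) (upper (suc k)) K (upper j)
    slope′ j k+1<j = ℤ.≤-trans (slope j k<j)
      (step-monotone-off-source step (upper j) (λ eq → ℕ.<⇒≢ k<j (sym (ℤ.+-injective (cong proj₁ eq)))))
      where
      k<j : k ℕ.< j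
      k<j = ℕ.<-trans (ℕ.n<1+n k) k+1<j

  ramp-up : ∀ t k {K} → Ramp k K → Σ Config λ K′ → Reachable n K K′ × Ramp (t ℕ.+ k) K′
  ramp-up zero    k ramp = _ , ε , ramp
  ramp-up (suc t) k ramp with ramp-step k ramp
  ... | K′ , steps , ramp′ with ramp-up t (suc k) ramp′
  ...   | K″ , steps′ , ramp″ = K″ , steps ◅◅ steps′ , subst (λ i → Ramp i K″) (ℕ.+-suc t k) ramp″

  ramp-top : ∀ {K} → Ramp n K → + 1 ℤ.≤ K (upper n)
  ramp-top {K} (peak , _) = subst (ℤ._≤ K (upper n)) ([x-x]+1≡1 (+ n)) peak
    where
    [x-x]+1≡1 : ∀ x → (x ℤ.- x) ℤ.+ + 1 ≡ + 1
    [x-x]+1≡1 = solve-∀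

  Az-upper-n : Az n (upper n) ≡ + 0
  Az-upper-n = Az-outside n (upper n)
    (subst (n ℕ.<_) (sym (dist₀-coords (+ n) (+ 1))) (ℕ.m<m+n n (s≤s z≤n)))

  non-Aztec-stabilisation :
    Σ Config (λ K* → Reachable n (pulse n r) K* × Stable n K* × ¬ (∀ f → K* f ≡ Az n f))
  non-Aztec-stabilisation
    with relax (_≟F upper 1) (λ K → + n ℤ.≤ K (upper 1))
           (λ _ n≤K s ¬frozen → ℤ.≤-trans n≤K (step-monotone-off-source s (upper 1) (¬frozen ∘ sym)))
           pulse-bounded (ℤ.≤-reflexive (sym pulse-upper-1))
  ... | K₁ , steps₁ , stable₁ , n≤K₁ with ramp-up m 1 (ramp-from-relaxed stable₁ n≤K₁)
  ... | K₂ , steps₂ , ramp₂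
    with relax ∅? (λ K → + 1 ℤ.≤ K (upper n))
           (λ β 1≤K s _ → step-preserves-positive (s≤s z≤n) (nonneg β) s (upper n) 1≤K)
           (bounded-reachable pulse-bounded (steps₁ ◅◅ steps₂))
           (ramp-top {K₂} (subst (λ i → Ramp i K₂) (ℕ.+-comm m 1) ramp₂))
  ... | K* , steps₃ , stable₃ , 1≤K* =
    K* , steps₁ ◅◅ steps₂ ◅◅ steps₃ , (λ _ s → stable₃ s) , not-Aztec
    where
    not-Aztec : ¬ (∀ f → K* f ≡ Az n f)
    not-Aztec K*≡Az with subst (+ 1 ℤ.≤_) (trans (K*≡Az (upper n)) Az-upper-n) 1≤K*
    ... | +≤+ ()

-- The bound r ≤ ⌈ n /2⌉ only serves to rule out n = 0.
theorem5p6 : (n r : ℕ) → 2 ≤ r → r ≤ ⌈ n /2⌉ →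
    Σ Config (λ K* → Reachable n (pulse n r) K* × Stable n K* × ¬ (∀ f → K* f ≡ Az n f))
theorem5p6 zero    r 2≤r r≤0 with ℕ.≤-trans 2≤r r≤0
... | ()
theorem5p6 (suc m) r 2≤r _ = NonAztecLimit.non-Aztec-stabilisation m r 2≤r
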